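{- Let $G=G(\mathbb{F}_2^r,M)$ be a Cayley graph with $M=(v_1,\dots,v_n)$ a generating list of $n$ nonzero vectors of $\mathbb{F}_2^r$. Then the largest cyclic factor $\mathbb{Z}/c_1(G)\mathbb{Z}$ of $K(G)$ satisfies \[ v_2(c_1(G))\le \lfloor\log_2 n\rfloor + r-1;\] that is, the largest $2$-cyclic factor $\mathbb{Z}/2^e\mathbb{Z}$ of $K(G)$ has $e\le\lfloor\log_2 n\rfloor+r-1$.
   Context: $G(\mathbb{F}_2^r,M)$ is the multigraph with vertex set $\mathbb{F}_2^r$ and one edge between $w$ and $w+v_i$ for each vertex $w$ and each $i$; $L(G)$ is its Laplacian. The sandpile group $K(G)$ is the torsion subgroup of $\operatorname{coker}L(G)\cong\mathbb{Z}\oplus K(G)$. Writing $K(G)=\bigoplus_{i=1}^d\mathbb{Z}/c_i(G)\mathbb{Z}$ with $c_d(G)\mid\cdots\mid c_1(G)$, $c_1(G)$ is the largest invariant factor. $v_2(x)$ denotes the exponent of the largest power of $2$ dividing $x$. -}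

module Defs where

open import Function using (_∘_)
open import Data.Bool using (Bool; true; false; _xor_; if_then_else_)
open import Data.Nat using (ℕ; zero; suc; _≤_; _^_)
open import Data.Nat.Divisibility using (_∣_)
open import Data.Integer using (ℤ; +_; _-_; _*_; _+_)
open import Data.Fin using (Fin; zero; suc)
open import Data.Vec using (Vec; replicate; zipWith)
open import Data.Product using (Σ; ∃; _×_)
open import Relation.Binary.PropositionalEquality using (_≡_; _≢_)

Vtx : ℕ → Set
Vtx r = Vec Bool r

_⊕_ : ∀ {r} → Vtx r → Vtx r → Vtx r
_⊕_ = zipWith _xor_

zeroV : ∀ r → Vtx r
zeroV r = replicate r false

sumFin : ∀ {n} → (Fin n → ℤ) → ℤ
sumFin {zero} f = + 0
sumFin {suc n} f = f zero + sumFin (f ∘ suc)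

lincomb : ∀ {r n} → (Fin n → Vtx r) → (Fin n → Bool) → Vtx r
lincomb {r} {zero} M S = zeroV r
lincomb {r} {suc n} M S =
  (if S zero then M zero else zeroV r) ⊕ lincomb (M ∘ suc) (S ∘ suc)

Generates : ∀ {r n} → (Fin n → Vtx r) → Set
Generates {r} {n} M = ∀ (u : Vtx r) → ∃ λ (S : Fin n → Bool) → lincomb M S ≡ u

AllNonzero : ∀ {r n} → (Fin n → Vtx r) → Set
AllNonzero {r} M = ∀ i → M i ≢ zeroV r

ZV : ℕ → Set
ZV r = Vtx r → ℤ

-- Laplacian L(G) = n·I − A, A_{w,u} = #{ i | u = w + v_i }, acting on Z^{F_2^r}:
-- (L y)(w) = n·y(w) − Σ_i y(w + v_i)
laplacian : ∀ {r n} → (Fin n → Vtx r) → ZV r → ZV r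
laplacian {r} {n} M y w = (+ n) * y w - sumFin (λ i → y (w ⊕ M i))

-- x lies in the image L(G)·Z^{F_2^r} (i.e. x ≡ 0 in coker L(G))
InImage : ∀ {r n} → (Fin n → Vtx r) → ZV r → Set
InImage {r} M x = ∃ λ (y : ZV r) → ∀ w → x w ≡ laplacian M y w

scale : ∀ {r} → ℤ → ZV r → ZV r
scale k x w = k * x w

-- the class of x in coker L(G) is a torsion element, i.e. lies in K(G)
Torsion : ∀ {r n} → (Fin n → Vtx r) → ZV r → Set
Torsion M x = ∃ λ (k : ℕ) → InImage M (scale (+ suc k) x)

Annihilates : ∀ {r n} → (Fin n → Vtx r) → ℕ → Set
Annihilates {r} M c = ∀ (x : ZV r) → Torsion M x → InImage M (scale (+ c) x)

-- c is c_1(G), the largest invariant factor of K(G) (= the exponent of K(G)):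
-- the positive generator of the annihilator ideal of K(G)
IsLargestInvariantFactor : ∀ {r n} → (Fin n → Vtx r) → ℕ → Set
IsLargestInvariantFactor M c =
  (1 ≤ c) × Annihilates M c × (∀ d → 1 ≤ d → Annihilates M d → c ∣ d)

v₂≤ : ℕ → ℕ → Set
v₂≤ c e = ∀ k → 2 ^ k ∣ c → k ≤ e

{-# OPTIONS --safe #-}
module Submission where

-- The characters χ a u = (−1)^(a·u) of F₂^r diagonalise the Laplacian: L χ_a = 2 d(a) χ_a with
-- d(a) = #{i | a·v_i = 1} ≤ n, and d(a) = 0 only if a is orthogonal to the span of the v_i, i.e. to
-- everything. Torsion classes are represented by x with Σ x = 0, so x̂(0) = 0 and Fourier inversion,
-- after dividing each coefficient by its eigenvalue, writes 2^(r−1) l x as L y with y integral,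
-- for any common multiple l of 1, …, n. Hence c₁ ∣ 2^(r−1) l, and l = 2^⌊log₂ n⌋ · 1 · 3 ⋯ (2n − 1)
-- has 2-adic valuation ⌊log₂ n⌋.

module TwoAdic where

  open import Data.Nat
  open import Data.Nat.Properties
  open import Data.Nat.Divisibility
  open import Data.Nat.Induction using (<-rec)
  open import Data.Nat.Logarithm using (⌊log₂_⌋; ⌊log₂⌋-mono-≤; ⌊log₂[2^n]⌋≡n)
  open import Data.Nat.Tactic.RingSolver using (solve-∀)
  open import Data.Product using (∃-syntax; ∃₂; _×_; _,_)
  open import Data.Sum using (_⊎_; inj₁; inj₂)
  open import Data.Empty using (⊥-elim)
  open import Relation.Binary.PropositionalEquality
  open import Defs using (v₂≤)

  Odd : ℕ → Set
  Odd o = ∃[ t ] o ≡ suc (2 * t)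

  even-or-odd : ∀ m → (∃[ k ] m ≡ 2 * k) ⊎ Odd m
  even-or-odd zero = inj₁ (0 , refl)
  even-or-odd (suc m) with even-or-odd m
  ... | inj₁ (k , refl) = inj₂ (k , refl)
  ... | inj₂ (t , refl) = inj₁ (suc t , cong suc (sym (+-suc t (t + 0))))

  odd⇒2∤ : ∀ {o} → Odd o → 2 ∤ o
  odd⇒2∤ (t , refl) (divides q eq) = even≢odd q t (trans (*-comm 2 q) (sym eq))

  odd-* : ∀ {a b} → Odd a → Odd b → Odd (a * b)
  odd-* (s , refl) (t , refl) = s + t + 2 * (s * t) , expand s t
    where
    expand : ∀ s t → suc (2 * s) * suc (2 * t) ≡ suc (2 * (s + t + 2 * (s * t)))
    expand = solve-∀

  odd⇒>0 : ∀ {o} → Odd o → 0 < o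
  odd⇒>0 (_ , refl) = s≤s z≤n

  2^j*odd : ∀ m → 0 < m → ∃₂ λ j o → Odd o × m ≡ 2 ^ j * o
  2^j*odd = <-rec _ split
    where
    split : ∀ m → (∀ {k} → k < m → 0 < k → ∃₂ λ j o → Odd o × k ≡ 2 ^ j * o) →
            0 < m → ∃₂ λ j o → Odd o × m ≡ 2 ^ j * o
    split m _ _ with even-or-odd m
    split m _ _ | inj₂ m-odd = 0 , m , m-odd , sym (*-identityˡ m)
    split _ _ 0<0 | inj₁ (zero , refl) = ⊥-elim (<-irrefl refl 0<0)
    split _ rec _ | inj₁ (suc k , refl) with rec (m<m+n (suc k) (s≤s z≤n)) (s≤s z≤n)
    ... | j , o , o-odd , k≡2^j*o =
      suc j , o , o-odd , trans (cong (2 *_) k≡2^j*o) (sym (*-assoc 2 (2 ^ j) o))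

  2^k∣2^e*odd⇒k≤e : ∀ {k e o} → Odd o → 2 ^ k ∣ 2 ^ e * o → k ≤ e
  2^k∣2^e*odd⇒k≤e {zero} _ _ = z≤n
  2^k∣2^e*odd⇒k≤e {suc k} {zero} {o} o-odd 2^k∣o =
    ⊥-elim (odd⇒2∤ o-odd (∣-trans (m∣m*n (2 ^ k)) (subst (2 ^ suc k ∣_) (*-identityˡ o) 2^k∣o)))
  2^k∣2^e*odd⇒k≤e {suc k} {suc e} {o} o-odd 2^k∣2^e*o =
    s≤s (2^k∣2^e*odd⇒k≤e o-odd
          (*-cancelˡ-∣ 2 (subst (2 * 2 ^ k ∣_) (*-assoc 2 (2 ^ e) o) 2^k∣2^e*o)))

  ^-monoʳ-∣ : ∀ b {j e} → j ≤ e → b ^ j ∣ b ^ e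
  ^-monoʳ-∣ b {j} j≤e with m≤n⇒∃[o]m+o≡n j≤e
  ... | o , refl = divides (b ^ o) (trans (^-distribˡ-+-* b j o) (*-comm (b ^ j) (b ^ o)))

  2^j≤n⇒j≤⌊log₂n⌋ : ∀ {j n} → 2 ^ j ≤ n → j ≤ ⌊log₂ n ⌋
  2^j≤n⇒j≤⌊log₂n⌋ {j} 2^j≤n = subst (_≤ _) (⌊log₂[2^n]⌋≡n j) (⌊log₂⌋-mono-≤ 2^j≤n)

  oddFactorial : ℕ → ℕ
  oddFactorial zero = 1
  oddFactorial (suc n) = suc (2 * n) * oddFactorial n

  oddFactorial-odd : ∀ n → Odd (oddFactorial n)
  oddFactorial-odd zero = 0 , refl
  oddFactorial-odd (suc n) = odd-* (n , refl) (oddFactorial-odd n)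

  ∣oddFactorial : ∀ {t n} → t < n → suc (2 * t) ∣ oddFactorial n
  ∣oddFactorial {n = suc n} t<1+n with m<1+n⇒m<n∨m≡n t<1+n
  ... | inj₁ t<n = ∣n⇒∣m*n (suc (2 * n)) (∣oddFactorial t<n)
  ... | inj₂ refl = m∣m*n (oddFactorial n)

  commonMultipleUpTo : ℕ → ℕ
  commonMultipleUpTo n = 2 ^ ⌊log₂ n ⌋ * oddFactorial n

  ∣commonMultipleUpTo : ∀ {m n} → 0 < m → m ≤ n → m ∣ commonMultipleUpTo n
  ∣commonMultipleUpTo {m} {n} 0<m m≤n with 2^j*odd m 0<m
  ... | j , _ , (t , refl) , refl =
    *-pres-∣ (^-monoʳ-∣ 2 (2^j≤n⇒j≤⌊log₂n⌋ {j} 2^j≤n)) (∣oddFactorial (≤-trans t<o o≤n))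
    where
    2^j≤n : 2 ^ j ≤ n
    2^j≤n = ≤-trans (m≤m*n (2 ^ j) (suc (2 * t))) m≤n
    o≤n : suc (2 * t) ≤ n
    o≤n = ≤-trans (m≤n*m (suc (2 * t)) (2 ^ j) {{m^n≢0 2 j}}) m≤n
    t<o : t < suc (2 * t)
    t<o = s≤s (m≤m+n t (t + 0))

  2^r*commonMultipleUpTo : ∀ r n →
                           2 ^ r * commonMultipleUpTo n ≡ 2 ^ (r + ⌊log₂ n ⌋) * oddFactorial n
  2^r*commonMultipleUpTo r n =
    trans (sym (*-assoc (2 ^ r) _ _)) (cong (_* oddFactorial n) (sym (^-distribˡ-+-* 2 r ⌊log₂ n ⌋)))

  v₂≤-of-∣ : ∀ {c e o} → Odd o → c ∣ 2 ^ e * o → v₂≤ c e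
  v₂≤-of-∣ o-odd c∣2^e*o k 2^k∣c = 2^k∣2^e*odd⇒k≤e o-odd (∣-trans 2^k∣c c∣2^e*o)

  2^e*odd>0 : ∀ e {o} → Odd o → 0 < 2 ^ e * o
  2^e*odd>0 e o-odd = *-mono-≤ (m^n>0 2 e) (odd⇒>0 o-odd)

module CubeLaplacian where

  open import Function using (_∘_)
  open import Algebra.Bundles using (CommutativeRing)
  import Algebra.Properties.CommutativeSemigroup as CommutativeSemigroupProperties
  open import Data.Bool using (Bool; true; false; not; _∧_; _xor_; if_then_else_)
  open import Data.Bool.Properties using (∧-zeroʳ; ∧-distribˡ-xor; xor-∧-commutativeRing)
  open import Data.Nat as ℕ using (ℕ; zero; suc; z≤n; s≤s)
  import Data.Nat.Properties as ℕ
  open import Data.Nat.Divisibility using (_∣_; divides)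
  open import Data.Integer using (ℤ; +_; -_; _+_; _-_; _*_; 0ℤ; 1ℤ; -1ℤ)
  open import Data.Integer.Properties
    using (+-comm; *-assoc; +-identityˡ; +-identityʳ; +-inverseˡ; +-inverseʳ; *-zeroʳ;
           *-identityˡ; *-identityʳ; *-distribˡ-+; neg-distrib-+; neg-involutive; *-cancelˡ-≡; pos-*)
    renaming (+-commutativeSemigroup to ℤ-+-commutativeSemigroup)
  open import Data.Integer.Tactic.RingSolver using (solve-∀)
  open import Data.Vec using (Vec; []; _∷_)
  open import Data.Fin using (Fin; zero; suc)
  open import Data.Product using (∃-syntax; _,_; proj₁; proj₂)
  open import Relation.Binary.PropositionalEquality
  open ≡-Reasoning
  open import Defs

  open CommutativeSemigroupProperties ℤ-+-commutativeSemigroup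
    using () renaming (interchange to +-interchange)
  open CommutativeSemigroupProperties (CommutativeRing.+-commutativeSemigroup xor-∧-commutativeRing)
    using () renaming (interchange to xor-interchange)

  private variable
    r s n : ℕ

  -- Sums over F₂^r

  sumVtx : (Vtx r → ℤ) → ℤ
  sumVtx {zero} f = f []
  sumVtx {suc r} f = sumVtx (f ∘ (true ∷_)) + sumVtx (f ∘ (false ∷_))

  sumVtx-cong : {f g : Vtx r → ℤ} → (∀ v → f v ≡ g v) → sumVtx f ≡ sumVtx g
  sumVtx-cong {zero} f≗g = f≗g []
  sumVtx-cong {suc r} f≗g =
    cong₂ _+_ (sumVtx-cong (f≗g ∘ (true ∷_))) (sumVtx-cong (f≗g ∘ (false ∷_)))

  sumVtx-zero : sumVtx {r} (λ _ → 0ℤ) ≡ 0ℤ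
  sumVtx-zero {zero} = refl
  sumVtx-zero {suc r} = cong₂ _+_ (sumVtx-zero {r}) (sumVtx-zero {r})

  sumVtx-distrib-+ : (f g : Vtx r → ℤ) → sumVtx (λ v → f v + g v) ≡ sumVtx f + sumVtx g
  sumVtx-distrib-+ {zero} f g = refl
  sumVtx-distrib-+ {suc r} f g = begin
    sumVtx (λ v → f (true ∷ v) + g (true ∷ v)) + sumVtx (λ v → f (false ∷ v) + g (false ∷ v))
      ≡⟨ cong₂ _+_ (sumVtx-distrib-+ (f ∘ (true ∷_)) (g ∘ (true ∷_)))
                   (sumVtx-distrib-+ (f ∘ (false ∷_)) (g ∘ (false ∷_))) ⟩
    (sumVtx (f ∘ (true ∷_)) + sumVtx (g ∘ (true ∷_)))
      + (sumVtx (f ∘ (false ∷_)) + sumVtx (g ∘ (false ∷_)))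
      ≡⟨ +-interchange (sumVtx (f ∘ (true ∷_))) (sumVtx (g ∘ (true ∷_))) _ _ ⟩
    sumVtx f + sumVtx g ∎

  *-distribˡ-sumVtx : (c : ℤ) (f : Vtx r → ℤ) → sumVtx (λ v → c * f v) ≡ c * sumVtx f
  *-distribˡ-sumVtx {zero} c f = refl
  *-distribˡ-sumVtx {suc r} c f =
    trans (cong₂ _+_ (*-distribˡ-sumVtx c (f ∘ (true ∷_))) (*-distribˡ-sumVtx c (f ∘ (false ∷_))))
          (sym (*-distribˡ-+ c (sumVtx (f ∘ (true ∷_))) (sumVtx (f ∘ (false ∷_)))))

  sumVtx-distrib-neg : (f : Vtx r → ℤ) → sumVtx (λ v → - f v) ≡ - sumVtx f
  sumVtx-distrib-neg {zero} f = refl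
  sumVtx-distrib-neg {suc r} f =
    trans (cong₂ _+_ (sumVtx-distrib-neg (f ∘ (true ∷_))) (sumVtx-distrib-neg (f ∘ (false ∷_))))
          (sym (neg-distrib-+ (sumVtx (f ∘ (true ∷_))) (sumVtx (f ∘ (false ∷_)))))

  sumVtx-distrib-- : (f g : Vtx r → ℤ) → sumVtx (λ v → f v - g v) ≡ sumVtx f - sumVtx g
  sumVtx-distrib-- f g =
    trans (sumVtx-distrib-+ f (λ v → - g v)) (cong (_+_ (sumVtx f)) (sumVtx-distrib-neg g))

  sumVtx-comm : (f : Vtx r → Vtx s → ℤ) →
                sumVtx (λ a → sumVtx (f a)) ≡ sumVtx (λ u → sumVtx (λ a → f a u))
  sumVtx-comm {zero} f = refl
  sumVtx-comm {suc r} f =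
    trans (cong₂ _+_ (sumVtx-comm (f ∘ (true ∷_))) (sumVtx-comm (f ∘ (false ∷_))))
          (sym (sumVtx-distrib-+ (λ u → sumVtx (λ a → f (true ∷ a) u))
                                 (λ u → sumVtx (λ a → f (false ∷ a) u))))

  sumVtx-translate : (v : Vtx r) (f : Vtx r → ℤ) → sumVtx (λ w → f (w ⊕ v)) ≡ sumVtx f
  sumVtx-translate [] f = refl
  sumVtx-translate (false ∷ v) f =
    cong₂ _+_ (sumVtx-translate v (f ∘ (true ∷_))) (sumVtx-translate v (f ∘ (false ∷_)))
  sumVtx-translate (true ∷ v) f =
    trans (cong₂ _+_ (sumVtx-translate v (f ∘ (false ∷_))) (sumVtx-translate v (f ∘ (true ∷_))))
          (+-comm (sumVtx (f ∘ (false ∷_))) (sumVtx (f ∘ (true ∷_))))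

  sumFin-cong : {f g : Fin n → ℤ} → (∀ i → f i ≡ g i) → sumFin f ≡ sumFin g
  sumFin-cong {zero} f≗g = refl
  sumFin-cong {suc n} f≗g = cong₂ _+_ (f≗g zero) (sumFin-cong (f≗g ∘ suc))

  sumFin-zero : sumFin {n} (λ _ → 0ℤ) ≡ 0ℤ
  sumFin-zero {zero} = refl
  sumFin-zero {suc n} = trans (+-identityˡ _) (sumFin-zero {n})

  *-distribˡ-sumFin : (c : ℤ) (f : Fin n → ℤ) → sumFin (λ i → c * f i) ≡ c * sumFin f
  *-distribˡ-sumFin {zero} c f = sym (*-zeroʳ c)
  *-distribˡ-sumFin {suc n} c f =
    trans (cong (_+_ (c * f zero)) (*-distribˡ-sumFin c (f ∘ suc))) (sym (*-distribˡ-+ c _ _))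

  sumFin-sumVtx-comm : (f : Fin n → Vtx r → ℤ) →
                       sumFin (λ i → sumVtx (f i)) ≡ sumVtx (λ v → sumFin (λ i → f i v))
  sumFin-sumVtx-comm {zero} {r} f = sym (sumVtx-zero {r})
  sumFin-sumVtx-comm {suc n} f =
    trans (cong (_+_ (sumVtx (f zero))) (sumFin-sumVtx-comm (f ∘ suc)))
          (sym (sumVtx-distrib-+ (f zero) (λ v → sumFin (λ i → f (suc i) v))))

  -- Characters of F₂^r

  infixl 7 _·_

  _·_ : Vtx r → Vtx r → Bool
  [] · [] = false
  (x ∷ a) · (y ∷ u) = (x ∧ y) xor (a · u)

  ·-zeroʳ : (a : Vtx r) → a · zeroV r ≡ false
  ·-zeroʳ [] = refl
  ·-zeroʳ (x ∷ a) = cong₂ _xor_ (∧-zeroʳ x) (·-zeroʳ a)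

  ·-distribˡ-⊕ : (a u w : Vtx r) → a · (u ⊕ w) ≡ (a · u) xor (a · w)
  ·-distribˡ-⊕ [] [] [] = refl
  ·-distribˡ-⊕ (x ∷ a) (y ∷ u) (z ∷ w) = begin
    (x ∧ (y xor z)) xor (a · (u ⊕ w))
      ≡⟨ cong₂ _xor_ (∧-distribˡ-xor x y z) (·-distribˡ-⊕ a u w) ⟩
    ((x ∧ y) xor (x ∧ z)) xor ((a · u) xor (a · w))
      ≡⟨ xor-interchange (x ∧ y) (x ∧ z) (a · u) (a · w) ⟩
    ((x ∧ y) xor (a · u)) xor ((x ∧ z) xor (a · w)) ∎

  ·-lincomb : (a : Vtx r) (M : Fin n → Vtx r) → (∀ i → a · M i ≡ false) →
              ∀ S → a · lincomb M S ≡ false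
  ·-lincomb {r} {zero} a M a⊥M S = ·-zeroʳ a
  ·-lincomb {r} {suc n} a M a⊥M S = begin
    a · ((if S zero then M zero else zeroV r) ⊕ lincomb (M ∘ suc) (S ∘ suc))
      ≡⟨ ·-distribˡ-⊕ a _ _ ⟩
    (a · (if S zero then M zero else zeroV r)) xor (a · lincomb (M ∘ suc) (S ∘ suc))
      ≡⟨ cong₂ _xor_ (a⊥head (S zero)) (·-lincomb a (M ∘ suc) (a⊥M ∘ suc) (S ∘ suc)) ⟩
    false ∎
    where
    a⊥head : ∀ b → a · (if b then M zero else zeroV r) ≡ false
    a⊥head true = a⊥M zero
    a⊥head false = ·-zeroʳ a

  ⊥-generators⇒⊥-all : {M : Fin n → Vtx r} → Generates M → (a : Vtx r) →
                       (∀ i → a · M i ≡ false) → ∀ u → a · u ≡ false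
  ⊥-generators⇒⊥-all {M = M} generates a a⊥M u with generates u
  ... | S , refl = ·-lincomb a M a⊥M S

  ⟦_⟧ : Bool → ℤ
  ⟦ true ⟧ = 1ℤ
  ⟦ false ⟧ = 0ℤ

  -1^_ : Bool → ℤ
  -1^ true = -1ℤ
  -1^ false = 1ℤ

  -1^-xor : ∀ b c → -1^ (b xor c) ≡ -1^ b * -1^ c
  -1^-xor true true = refl
  -1^-xor true false = refl
  -1^-xor false true = refl
  -1^-xor false false = refl

  -1^-not : ∀ b → -1^ (not b) ≡ - -1^ b
  -1^-not true = refl
  -1^-not false = refl

  2⟦b⟧≡1--1^b : ∀ b → + 2 * ⟦ b ⟧ ≡ 1ℤ - -1^ b
  2⟦b⟧≡1--1^b true = refl
  2⟦b⟧≡1--1^b false = refl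

  ⟦b⟧-⟦b-xor-c⟧ : ∀ b c → ⟦ b ⟧ - ⟦ b xor c ⟧ ≡ - -1^ b * ⟦ c ⟧
  ⟦b⟧-⟦b-xor-c⟧ true true = refl
  ⟦b⟧-⟦b-xor-c⟧ true false = refl
  ⟦b⟧-⟦b-xor-c⟧ false true = refl
  ⟦b⟧-⟦b-xor-c⟧ false false = refl

  χ : Vtx r → Vtx r → ℤ
  χ a u = -1^ (a · u)

  fourier : (Vtx r → ℤ) → Vtx r → ℤ
  fourier x a = sumVtx (λ u → x u * χ a u)

  -- δ z = 2 ^ r if z is zero, and 0 otherwise
  δ : Vtx r → ℤ
  δ [] = 1ℤ
  δ (true ∷ z) = 0ℤ
  δ (false ∷ z) = + 2 * δ z

  orthogonality : (z : Vtx r) → sumVtx (λ a → χ a z) ≡ δ z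
  orthogonality [] = refl
  orthogonality (true ∷ z) = begin
    sumVtx (λ a → -1^ (not (a · z))) + sumVtx (λ a → χ a z)
      ≡⟨ cong (_+ sumVtx (λ a → χ a z))
              (trans (sumVtx-cong (λ a → -1^-not (a · z))) (sumVtx-distrib-neg (λ a → χ a z))) ⟩
    - sumVtx (λ a → χ a z) + sumVtx (λ a → χ a z)
      ≡⟨ +-inverseˡ (sumVtx (λ a → χ a z)) ⟩
    0ℤ ∎
  orthogonality (false ∷ z) = trans (cong₂ _+_ (orthogonality z) (orthogonality z)) (double (δ z))
    where
    double : ∀ d → d + d ≡ + 2 * d
    double = solve-∀

  χ-distribʳ-⊕ : (a u w : Vtx r) → χ a (u ⊕ w) ≡ χ a u * χ a w
  χ-distribʳ-⊕ a u w = trans (cong -1^_ (·-distribˡ-⊕ a u w)) (-1^-xor (a · u) (a · w))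

  2*[2^r*y]≡2^[1+r]*y : ∀ r y → + 2 * (+ (2 ℕ.^ r) * y) ≡ + (2 ℕ.^ suc r) * y
  2*[2^r*y]≡2^[1+r]*y r y =
    trans (sym (*-assoc (+ 2) (+ (2 ℕ.^ r)) y)) (cong (_* y) (sym (pos-* 2 (2 ℕ.^ r))))

  sumVtx-*-zero : (f : Vtx r → ℤ) → sumVtx (λ u → f u * 0ℤ) ≡ 0ℤ
  sumVtx-*-zero {r} f = trans (sumVtx-cong (*-zeroʳ ∘ f)) (sumVtx-zero {r})

  sumVtx-*-2* : (f g : Vtx r → ℤ) →
                sumVtx (λ u → f u * (+ 2 * g u)) ≡ + 2 * sumVtx (λ u → f u * g u)
  sumVtx-*-2* f g =
    trans (sumVtx-cong (λ u → swap (f u) (g u))) (*-distribˡ-sumVtx (+ 2) (λ u → f u * g u))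
    where
    swap : ∀ y d → y * (+ 2 * d) ≡ + 2 * (y * d)
    swap = solve-∀

  sumVtx-*-δ : (x : Vtx r → ℤ) (w : Vtx r) → sumVtx (λ u → x u * δ (u ⊕ w)) ≡ + (2 ℕ.^ r) * x w
  sumVtx-*-δ x [] = trans (*-identityʳ (x [])) (sym (*-identityˡ (x [])))
  sumVtx-*-δ {suc r} x (true ∷ w) = begin
    sumVtx (λ u → x (true ∷ u) * (+ 2 * δ (u ⊕ w))) + sumVtx (λ u → x (false ∷ u) * 0ℤ)
      ≡⟨ cong₂ _+_ (sumVtx-*-2* (x ∘ (true ∷_)) (λ u → δ (u ⊕ w))) (sumVtx-*-zero (x ∘ (false ∷_))) ⟩
    + 2 * sumVtx (λ u → x (true ∷ u) * δ (u ⊕ w)) + 0ℤ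
      ≡⟨ +-identityʳ _ ⟩
    + 2 * sumVtx (λ u → x (true ∷ u) * δ (u ⊕ w))
      ≡⟨ cong (+ 2 *_) (sumVtx-*-δ (x ∘ (true ∷_)) w) ⟩
    + 2 * (+ (2 ℕ.^ r) * x (true ∷ w))
      ≡⟨ 2*[2^r*y]≡2^[1+r]*y r _ ⟩
    + (2 ℕ.^ suc r) * x (true ∷ w) ∎
  sumVtx-*-δ {suc r} x (false ∷ w) = begin
    sumVtx (λ u → x (true ∷ u) * 0ℤ) + sumVtx (λ u → x (false ∷ u) * (+ 2 * δ (u ⊕ w)))
      ≡⟨ cong₂ _+_ (sumVtx-*-zero (x ∘ (true ∷_))) (sumVtx-*-2* (x ∘ (false ∷_)) (λ u → δ (u ⊕ w))) ⟩
    0ℤ + + 2 * sumVtx (λ u → x (false ∷ u) * δ (u ⊕ w))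
      ≡⟨ +-identityˡ _ ⟩
    + 2 * sumVtx (λ u → x (false ∷ u) * δ (u ⊕ w))
      ≡⟨ cong (+ 2 *_) (sumVtx-*-δ (x ∘ (false ∷_)) w) ⟩
    + 2 * (+ (2 ℕ.^ r) * x (false ∷ w))
      ≡⟨ 2*[2^r*y]≡2^[1+r]*y r _ ⟩
    + (2 ℕ.^ suc r) * x (false ∷ w) ∎

  fourier-inversion : (x : Vtx r → ℤ) (w : Vtx r) →
                      sumVtx (λ a → χ a w * fourier x a) ≡ + (2 ℕ.^ r) * x w
  fourier-inversion {r} x w = begin
    sumVtx (λ a → χ a w * sumVtx (λ u → x u * χ a u))
      ≡⟨ sumVtx-cong (λ a → sym (*-distribˡ-sumVtx (χ a w) (λ u → x u * χ a u))) ⟩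
    sumVtx (λ a → sumVtx (λ u → χ a w * (x u * χ a u)))
      ≡⟨ sumVtx-cong (λ a → sumVtx-cong (λ u → shift a u)) ⟩
    sumVtx (λ a → sumVtx (λ u → x u * χ a (u ⊕ w)))
      ≡⟨ sumVtx-comm (λ a u → x u * χ a (u ⊕ w)) ⟩
    sumVtx (λ u → sumVtx (λ a → x u * χ a (u ⊕ w)))
      ≡⟨ sumVtx-cong (λ u → trans (*-distribˡ-sumVtx (x u) (λ a → χ a (u ⊕ w)))
                                  (cong (x u *_) (orthogonality (u ⊕ w)))) ⟩
    sumVtx (λ u → x u * δ (u ⊕ w))
      ≡⟨ sumVtx-*-δ x w ⟩
    + (2 ℕ.^ r) * x w ∎
    where
    reorder : ∀ c y d → c * (y * d) ≡ y * (d * c)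
    reorder = solve-∀
    shift : ∀ a u → χ a w * (x u * χ a u) ≡ x u * χ a (u ⊕ w)
    shift a u = trans (reorder (χ a w) (x u) (χ a u)) (cong (x u *_) (sym (χ-distribʳ-⊕ a u w)))

  -- The Laplacian of G(F₂^r, M)

  laplacian≡sumFin-differences : (M : Fin n → Vtx r) (y : ZV r) (w : Vtx r) →
                                 laplacian M y w ≡ sumFin (λ i → y w - y (w ⊕ M i))
  laplacian≡sumFin-differences {zero} M y w = refl
  laplacian≡sumFin-differences {suc n} M y w =
    trans (peel (+ n) (y w) (y (w ⊕ M zero)) (sumFin (λ i → y (w ⊕ M (suc i)))))
          (cong (_+_ (y w - y (w ⊕ M zero))) (laplacian≡sumFin-differences (M ∘ suc) y w))
    where
    peel : ∀ m a b s → (1ℤ + m) * a - (b + s) ≡ (a - b) + (m * a - s)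
    peel = solve-∀

  laplacian-scale : (M : Fin n → Vtx r) (k : ℤ) (y : ZV r) (w : Vtx r) →
                    laplacian M (scale k y) w ≡ k * laplacian M y w
  laplacian-scale {n} M k y w =
    trans (cong (λ s → + n * (k * y w) - s) (*-distribˡ-sumFin k (λ i → y (w ⊕ M i))))
          (factor (+ n) k (y w) (sumFin (λ i → y (w ⊕ M i))))
    where
    factor : ∀ m k a s → m * (k * a) - k * s ≡ k * (m * a - s)
    factor = solve-∀

  laplacian-sumVtx : (M : Fin n → Vtx r) (f : Vtx s → ZV r) (w : Vtx r) →
                     laplacian M (λ v → sumVtx (λ a → f a v)) w ≡ sumVtx (λ a → laplacian M (f a) w)
  laplacian-sumVtx {n} M f w = begin
    + n * sumVtx (λ a → f a w) - sumFin (λ i → sumVtx (λ a → f a (w ⊕ M i)))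
      ≡⟨ cong₂ _-_ (sym (*-distribˡ-sumVtx (+ n) (λ a → f a w)))
                   (sumFin-sumVtx-comm (λ i a → f a (w ⊕ M i))) ⟩
    sumVtx (λ a → + n * f a w) - sumVtx (λ a → sumFin (λ i → f a (w ⊕ M i)))
      ≡⟨ sym (sumVtx-distrib-- (λ a → + n * f a w) (λ a → sumFin (λ i → f a (w ⊕ M i)))) ⟩
    sumVtx (λ a → laplacian M (f a) w) ∎

  sumVtx-laplacian : (M : Fin n → Vtx r) (y : ZV r) → sumVtx (laplacian M y) ≡ 0ℤ
  sumVtx-laplacian {n} M y = begin
    sumVtx (laplacian M y)
      ≡⟨ sumVtx-cong (laplacian≡sumFin-differences M y) ⟩
    sumVtx (λ w → sumFin (λ i → y w - y (w ⊕ M i)))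
      ≡⟨ sym (sumFin-sumVtx-comm (λ i w → y w - y (w ⊕ M i))) ⟩
    sumFin (λ i → sumVtx (λ w → y w - y (w ⊕ M i)))
      ≡⟨ sumFin-cong (λ i → trans (sumVtx-distrib-- y (λ w → y (w ⊕ M i)))
                                  (cong (_-_ (sumVtx y)) (sumVtx-translate (M i) y))) ⟩
    sumFin {n} (λ _ → sumVtx y - sumVtx y)
      ≡⟨ sumFin-cong {n} (λ _ → +-inverseʳ (sumVtx y)) ⟩
    sumFin {n} (λ _ → 0ℤ)
      ≡⟨ sumFin-zero {n} ⟩
    0ℤ ∎

  torsion⇒sumVtx≡0 : (M : Fin n → Vtx r) {x : ZV r} → Torsion M x → sumVtx x ≡ 0ℤ
  torsion⇒sumVtx≡0 M {x} (k , y , [k+1]x≡Ly) = *-cancelˡ-≡ (+ suc k) (sumVtx x) 0ℤ (begin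
    + suc k * sumVtx x          ≡⟨ sym (*-distribˡ-sumVtx (+ suc k) x) ⟩
    sumVtx (scale (+ suc k) x)  ≡⟨ sumVtx-cong [k+1]x≡Ly ⟩
    sumVtx (laplacian M y)      ≡⟨ sumVtx-laplacian M y ⟩
    0ℤ                          ≡⟨ sym (*-zeroʳ (+ suc k)) ⟩
    + suc k * 0ℤ                ∎)

  count : (Fin n → Bool) → ℕ
  count {zero} p = 0
  count {suc n} p = if p zero then suc (count (p ∘ suc)) else count (p ∘ suc)

  sumFin-⟦⟧≡count : (p : Fin n → Bool) → sumFin (λ i → ⟦ p i ⟧) ≡ + count p
  sumFin-⟦⟧≡count {zero} p = refl
  sumFin-⟦⟧≡count {suc n} p with p zero
  ... | true = cong (_+_ 1ℤ) (sumFin-⟦⟧≡count (p ∘ suc))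
  ... | false = trans (+-identityˡ _) (sumFin-⟦⟧≡count (p ∘ suc))

  count≤n : (p : Fin n → Bool) → count p ℕ.≤ n
  count≤n {zero} p = z≤n
  count≤n {suc n} p with p zero
  ... | true = s≤s (count≤n (p ∘ suc))
  ... | false = ℕ.m≤n⇒m≤1+n (count≤n (p ∘ suc))

  count≡0⇒≡false : (p : Fin n → Bool) → count p ≡ 0 → ∀ i → p i ≡ false
  count≡0⇒≡false {suc n} p count≡0 i with p zero in p0≡
  count≡0⇒≡false {suc n} p () i | true
  count≡0⇒≡false {suc n} p count≡0 zero | false = p0≡
  count≡0⇒≡false {suc n} p count≡0 (suc i) | false = count≡0⇒≡false (p ∘ suc) count≡0 i

  laplacian-⟦·⟧ : (M : Fin n → Vtx r) (a w : Vtx r) →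
                  laplacian M (λ v → ⟦ a · v ⟧) w ≡ - χ a w * + count (λ i → a · M i)
  laplacian-⟦·⟧ M a w = begin
    laplacian M (λ v → ⟦ a · v ⟧) w
      ≡⟨ laplacian≡sumFin-differences M (λ v → ⟦ a · v ⟧) w ⟩
    sumFin (λ i → ⟦ a · w ⟧ - ⟦ a · (w ⊕ M i) ⟧)
      ≡⟨ sumFin-cong (λ i → trans (cong (λ b → ⟦ a · w ⟧ - ⟦ b ⟧) (·-distribˡ-⊕ a w (M i)))
                                  (⟦b⟧-⟦b-xor-c⟧ (a · w) (a · M i))) ⟩
    sumFin (λ i → - χ a w * ⟦ a · M i ⟧)
      ≡⟨ *-distribˡ-sumFin (- χ a w) (λ i → ⟦ a · M i ⟧) ⟩
    - χ a w * sumFin (λ i → ⟦ a · M i ⟧)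
      ≡⟨ cong (- χ a w *_) (sumFin-⟦⟧≡count (λ i → a · M i)) ⟩
    - χ a w * + count (λ i → a · M i) ∎

  module Preimage {n r : ℕ} (M : Fin n → Vtx r) (generates : Generates M)
                  (l : ℕ) (l-multiple : ∀ {m} → 0 ℕ.< m → m ℕ.≤ n → m ∣ l)
                  (x : ZV r) (x-sum : sumVtx x ≡ 0ℤ) where

    X : Vtx r → ℤ
    X a = sumVtx (λ u → x u * ⟦ a · u ⟧)

    fourier≡-2X : ∀ a → fourier x a ≡ - (+ 2 * X a)
    fourier≡-2X a = sym (begin
      - (+ 2 * X a)
        ≡⟨ cong -_ (sym (*-distribˡ-sumVtx (+ 2) (λ u → x u * ⟦ a · u ⟧))) ⟩
      - sumVtx (λ u → + 2 * (x u * ⟦ a · u ⟧))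
        ≡⟨ cong -_ (sumVtx-cong (λ u → trans (reorder (x u) ⟦ a · u ⟧)
                                             (cong (λ t → x u * t) (2⟦b⟧≡1--1^b (a · u))))) ⟩
      - sumVtx (λ u → x u * (1ℤ - χ a u))
        ≡⟨ cong -_ (sumVtx-cong (λ u → *-distribˡ-- (x u) (χ a u))) ⟩
      - sumVtx (λ u → x u - x u * χ a u)
        ≡⟨ cong -_ (sumVtx-distrib-- x (λ u → x u * χ a u)) ⟩
      - (sumVtx x - fourier x a)
        ≡⟨ cong (λ t → - (t - fourier x a)) x-sum ⟩
      - (0ℤ - fourier x a)
        ≡⟨ cong -_ (+-identityˡ (- fourier x a)) ⟩
      - - fourier x a
        ≡⟨ neg-involutive (fourier x a) ⟩
      fourier x a ∎)
      where
      reorder : ∀ y b → + 2 * (y * b) ≡ y * (+ 2 * b)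
      reorder = solve-∀
      *-distribˡ-- : ∀ y c → y * (1ℤ - c) ≡ y - y * c
      *-distribˡ-- = solve-∀

    X≡0 : ∀ a → (∀ i → a · M i ≡ false) → X a ≡ 0ℤ
    X≡0 a a⊥M =
      trans (sumVtx-cong (λ u → cong (λ b → x u * ⟦ b ⟧)
                                     (⊥-generators⇒⊥-all generates a a⊥M u)))
            (sumVtx-*-zero x)

    degree : Vtx r → ℕ
    degree a = count (λ i → a · M i)

    degree∣l*X : ∀ a → ∃[ K ] K * + degree a ≡ + l * X a
    degree∣l*X a with degree a in degree≡
    ... | zero =
      0ℤ , sym (trans (cong (+ l *_) (X≡0 a (count≡0⇒≡false (λ i → a · M i) degree≡))) (*-zeroʳ (+ l)))
    ... | suc d with l-multiple (s≤s z≤n) (subst (ℕ._≤ n) degree≡ (count≤n (λ i → a · M i)))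
    ...   | divides q refl =
      + q * X a , trans (reorder (+ q) (X a) (+ suc d)) (cong (_* X a) (sym (pos-* q (suc d))))
      where
      reorder : ∀ q y d → (q * y) * d ≡ (q * d) * y
      reorder = solve-∀

    weight : Vtx r → ℤ
    weight a = proj₁ (degree∣l*X a)

    -- Expanding in ⟦ a · w ⟧ = (1 − χ a w) / 2 rather than in χ a w halves the eigenvalue
    -- 2 · degree a (constants lie in the kernel), which is what saves a factor 2.
    preimage : ZV r
    preimage w = sumVtx (λ a → weight a * ⟦ a · w ⟧)

    laplacian-preimage : ∀ w → laplacian M preimage w ≡ - sumVtx (λ a → χ a w * (+ l * X a))
    laplacian-preimage w = begin
      laplacian M preimage w
        ≡⟨ laplacian-sumVtx M (λ a → scale (weight a) (λ v → ⟦ a · v ⟧)) w ⟩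
      sumVtx (λ a → laplacian M (scale (weight a) (λ v → ⟦ a · v ⟧)) w)
        ≡⟨ sumVtx-cong (λ a → trans (laplacian-scale M (weight a) (λ v → ⟦ a · v ⟧) w)
                                    (cong (weight a *_) (laplacian-⟦·⟧ M a w))) ⟩
      sumVtx (λ a → weight a * (- χ a w * + degree a))
        ≡⟨ sumVtx-cong (λ a → trans (reorder (weight a) (χ a w) (+ degree a))
                                    (cong (λ t → - (χ a w * t)) (proj₂ (degree∣l*X a)))) ⟩
      sumVtx (λ a → - (χ a w * (+ l * X a)))
        ≡⟨ sumVtx-distrib-neg (λ a → χ a w * (+ l * X a)) ⟩
      - sumVtx (λ a → χ a w * (+ l * X a)) ∎
      where
      reorder : ∀ k c d → k * (- c * d) ≡ - (c * (k * d))
      reorder = solve-∀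

    2*laplacian-preimage : ∀ w → + 2 * laplacian M preimage w ≡ + l * (+ (2 ℕ.^ r) * x w)
    2*laplacian-preimage w = begin
      + 2 * laplacian M preimage w
        ≡⟨ cong (+ 2 *_) (laplacian-preimage w) ⟩
      + 2 * - sumVtx (λ a → χ a w * (+ l * X a))
        ≡⟨ cong (+ 2 *_) (sym (sumVtx-distrib-neg (λ a → χ a w * (+ l * X a)))) ⟩
      + 2 * sumVtx (λ a → - (χ a w * (+ l * X a)))
        ≡⟨ sym (*-distribˡ-sumVtx (+ 2) (λ a → - (χ a w * (+ l * X a)))) ⟩
      sumVtx (λ a → + 2 * - (χ a w * (+ l * X a)))
        ≡⟨ sumVtx-cong term ⟩
      sumVtx (λ a → + l * (χ a w * fourier x a))
        ≡⟨ *-distribˡ-sumVtx (+ l) (λ a → χ a w * fourier x a) ⟩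
      + l * sumVtx (λ a → χ a w * fourier x a)
        ≡⟨ cong (+ l *_) (fourier-inversion x w) ⟩
      + l * (+ (2 ℕ.^ r) * x w) ∎
      where
      reorder : ∀ c l y → + 2 * - (c * (l * y)) ≡ l * (c * - (+ 2 * y))
      reorder = solve-∀
      term : ∀ a → + 2 * - (χ a w * (+ l * X a)) ≡ + l * (χ a w * fourier x a)
      term a =
        trans (reorder (χ a w) (+ l) (X a)) (cong (λ t → + l * (χ a w * t)) (sym (fourier≡-2X a)))

  annihilates-2^r*l : (M : Fin n → Vtx (suc r)) → Generates M →
                      {l : ℕ} → (∀ {m} → 0 ℕ.< m → m ℕ.≤ n → m ∣ l) →
                      Annihilates M (2 ℕ.^ r ℕ.* l)
  annihilates-2^r*l {n} {r} M generates {l} l-multiple x x-torsion =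
    preimage , λ w → *-cancelˡ-≡ (+ 2) _ _ (trans (regroup w) (sym (2*laplacian-preimage w)))
    where
    open Preimage M generates l l-multiple x (torsion⇒sumVtx≡0 M x-torsion)
    reorder : ∀ p l y → + 2 * ((p * l) * y) ≡ l * ((+ 2 * p) * y)
    reorder = solve-∀
    regroup : ∀ w → + 2 * (+ (2 ℕ.^ r ℕ.* l) * x w) ≡ + l * (+ (2 ℕ.^ suc r) * x w)
    regroup w = begin
      + 2 * (+ (2 ℕ.^ r ℕ.* l) * x w)      ≡⟨ cong (λ t → + 2 * (t * x w)) (pos-* (2 ℕ.^ r) l) ⟩
      + 2 * ((+ (2 ℕ.^ r) * + l) * x w)    ≡⟨ reorder (+ (2 ℕ.^ r)) (+ l) (x w) ⟩
      + l * ((+ 2 * + (2 ℕ.^ r)) * x w)    ≡⟨ cong (λ t → + l * (t * x w)) (sym (pos-* 2 (2 ℕ.^ r))) ⟩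
      + l * (+ (2 ℕ.^ suc r) * x w)        ∎

  annihilates-1 : (M : Fin n → Vtx 0) → Annihilates M 1
  annihilates-1 {n} M x x-torsion = (λ _ → 0ℤ) , λ { [] → begin
    + 1 * x []                      ≡⟨ *-identityˡ (x []) ⟩
    sumVtx x                        ≡⟨ torsion⇒sumVtx≡0 M x-torsion ⟩
    0ℤ                              ≡⟨ sym (sumFin-zero {n}) ⟩
    sumFin {n} (λ _ → 0ℤ)           ≡⟨ sym (laplacian≡sumFin-differences M (λ _ → 0ℤ) []) ⟩
    laplacian M (λ _ → 0ℤ) []       ∎ }

open import Defs
open import Data.Nat using (ℕ; zero; suc; _+_; _∸_; _^_; _*_; _≤_; z≤n)
open import Data.Nat.Properties using (≤-refl; ≤-trans; +-comm; +-suc)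
open import Data.Nat.Divisibility using (_∣_)
open import Data.Nat.Logarithm using (⌊log₂_⌋)
open import Data.Fin using (Fin)
open import Data.Product using (_,_)
open import Relation.Binary.PropositionalEquality using (_≡_; refl; sym; trans; cong; subst)
open TwoAdic
open CubeLaplacian using (annihilates-1; annihilates-2^r*l)

mainTheorem4 : (r n : ℕ) (M : Fin n → Vtx r) → AllNonzero M → Generates M →
    (c : ℕ) → IsLargestInvariantFactor M c → v₂≤ c (⌊log₂ n ⌋ + r ∸ 1)
mainTheorem4 zero n M _ _ c (_ , _ , c∣annihilator) k 2^k∣c =
  ≤-trans (v₂≤-of-∣ (0 , refl) (c∣annihilator 1 ≤-refl (annihilates-1 M)) k 2^k∣c) z≤n
mainTheorem4 (suc r) n M _ generates c (_ , _ , c∣annihilator) k 2^k∣c =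
  subst (k ≤_) exponent (v₂≤-of-∣ odd (c∣annihilator _ (2^e*odd>0 e odd) annihilator) k 2^k∣c)
  where
  e : ℕ
  e = r + ⌊log₂ n ⌋
  odd : Odd (oddFactorial n)
  odd = oddFactorial-odd n
  annihilator : Annihilates M (2 ^ e * oddFactorial n)
  annihilator = subst (Annihilates M) (2^r*commonMultipleUpTo r n)
                      (annihilates-2^r*l M generates ∣commonMultipleUpTo)
  exponent : e ≡ ⌊log₂ n ⌋ + suc r ∸ 1
  exponent = trans (+-comm r ⌊log₂ n ⌋) (cong (_∸ 1) (sym (+-suc ⌊log₂ n ⌋ r)))
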